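{- Let $G=(V,B)$ be a finite simple undirected graph, let $w:V\to[0,\infty)$ with $\sum_{x\in V}w(x)=1$, and let $a,b\in V$ be distinct vertices with $\{a,b\}\notin B$. Let $G_a$ be the graph obtained from $G$ by deleting the vertex $b$, with weights $w_a$ given by $w_a(a)=w(a)+w(b)$ and $w_a(x)=w(x)$ for $x\ne a$; let $G_b$ be the graph obtained from $G$ by deleting $a$, with weights $w_b(b)=w(a)+w(b)$ and $w_b(x)=w(x)$ for $x\ne b$. For a graph $H=(U,C)$ with weights $v:U\to[0,\infty)$ define $$\mathcal{L}_{BF}(H)=\sum_{\{x,y,z\}\in E_H}v(x)v(y)v(z)+\frac12\sum_{\{x,y\}\in C}\big(v(x)^2v(y)+v(x)v(y)^2\big)-\frac12\Big(\sum_{\{x,y\}\in C}v(x)v(y)\Big)^2,$$ where $E_H$ is the set of $3$-subsets of $U$ inducing at least $2$ edges of $H$ and sums over $C$ run over unordered edges. Then $\mathcal{L}_{BF}(G)\le\mathcal{L}_{BF}(G_a)$ (computed with $w_a$) or $\mathcal{L}_{BF}(G)\le\mathcal{L}_{BF}(G_b)$ (computed with $w_b$). -}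

module Defs where

open import Level using (Level; _⊔_) renaming (suc to lsuc)
open import Algebra.Bundles using (CommutativeRing)
open import Relation.Binary.Core using (Rel)
open import Relation.Binary.Structures using (IsTotalOrder)
open import Relation.Nullary using (¬_)
open import Data.Product using (∃)
open import Data.Bool using (Bool; true; false; if_then_else_)
open import Data.Nat using (ℕ; zero; suc; _<ᵇ_; _≤ᵇ_) renaming (_+_ to _+ℕ_)
open import Data.Fin using (Fin; toℕ; punchIn; _≟_)
open import Relation.Binary.PropositionalEquality using (_≡_; _≢_)
open import Relation.Nullary.Decidable using (⌊_⌋)

-- An ordered field (ℝ is an instance).  Weights are taken in an
-- arbitrary ordered field F.

record OrderedField (c ℓ₁ ℓ₂ : Level) : Set (lsuc (c ⊔ ℓ₁ ⊔ ℓ₂)) where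
  field
    commutativeRing : CommutativeRing c ℓ₁
  open CommutativeRing commutativeRing public
  field
    _≤_          : Rel Carrier ℓ₂
    isTotalOrder : IsTotalOrder _≈_ _≤_
    0≉1          : ¬ (0# ≈ 1#)
    inverse      : ∀ x → ¬ (x ≈ 0#) → ∃ λ y → x * y ≈ 1#
    +-monoˡ-≤    : ∀ {x y} z → x ≤ y → (x + z) ≤ (y + z)
    *-nonneg     : ∀ {x y} → 0# ≤ x → 0# ≤ y → 0# ≤ (x * y)

record SimpleGraph (n : ℕ) : Set where
  field
    adj     : Fin n → Fin n → Bool
    adj-sym : ∀ x y → adj x y ≡ adj y x
    irrefl  : ∀ x → adj x x ≡ false
open SimpleGraph public

deleteVertex : ∀ {m} → Fin (suc m) → SimpleGraph (suc m) → SimpleGraph m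
deleteVertex b G = record
  { adj     = λ i j → adj G (punchIn b i) (punchIn b j)
  ; adj-sym = λ i j → adj-sym G (punchIn b i) (punchIn b j)
  ; irrefl  = λ i → irrefl G (punchIn b i)
  }

boolToℕ : Bool → ℕ
boolToℕ true  = 1
boolToℕ false = 0

inducedEdges : ∀ {n} → SimpleGraph n → Fin n → Fin n → Fin n → ℕ
inducedEdges G x y z =
  boolToℕ (adj G x y) +ℕ boolToℕ (adj G x z) +ℕ boolToℕ (adj G y z)

module _ {c ℓ₁ ℓ₂} (F : OrderedField c ℓ₁ ℓ₂) where
  open OrderedField F

  sumFin : ∀ n → (Fin n → Carrier) → Carrier
  sumFin zero    f = 0#
  sumFin (suc n) f = f Fin.zero + sumFin n (λ i → f (Fin.suc i))

  _<F_ : ∀ {n} → Fin n → Fin n → Bool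
  i <F j = toℕ i <ᵇ toℕ j

  sumEdges : ∀ {n} → SimpleGraph n → (Fin n → Fin n → Carrier) → Carrier
  sumEdges {n} G f =
    sumFin n λ x → sumFin n λ y →
      if (x <F y) then (if adj G x y then f x y else 0#) else 0#

  sumE : ∀ {n} → SimpleGraph n → (Fin n → Fin n → Fin n → Carrier) → Carrier
  sumE {n} G f =
    sumFin n λ x → sumFin n λ y → sumFin n λ z →
      if (x <F y) then
        (if (y <F z) then
          (if (2 ≤ᵇ inducedEdges G x y z) then f x y z else 0#)
        else 0#)
      else 0#

  -- 𝓛_BF(H) for H with weights v; `half` is 1/2 in F.
  LBF : ∀ {n} → Carrier → SimpleGraph n → (Fin n → Carrier) → Carrier
  LBF half H v =
    sumE H (λ x y z → v x * v y * v z)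
    + half * sumEdges H (λ x y → v x * v x * v y + v x * v y * v y)
    - half * (sumEdges H (λ x y → v x * v y) * sumEdges H (λ x y → v x * v y))

  mergedWeights : ∀ {m} → (Fin (suc m) → Carrier) → (keep del : Fin (suc m))
                → Fin m → Carrier
  mergedWeights w keep del i =
    if ⌊ punchIn del i ≟ keep ⌋ then w keep + w del else w (punchIn del i)

-- The merged graphs are the two ends of the segment w + τ d, d = δ a − δ b,
-- − w a ≤ τ ≤ w b: at either end a or b has weight zero and can be deleted
-- without changing LBF.  Along the segment LBF is a polynomial in τ whose
-- coefficients collapse via ∑ₓ d x · f x = f a − f b.  It has no cubic term,
-- since d is supported on the non-edge {a, b} and so never non-zero at all
-- three vertices of a triple or at both ends of an edge.  Writing X and Y for
-- the weights of the vertices adjacent to exactly one of a and b, the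
-- quadratic coefficient is ½ ((X + Y) − (X − Y)²) ≥ 0, as X + Y ≤ 1.  So LBF
-- changes by τ β + τ² α with α ≥ 0, and one of the two ends has τ β ≥ 0.

module Submission where

open import Defs
open import Level using (Level)
open import Algebra.Bundles using (CommutativeRing; RawRing)
open import Data.Bool using (Bool; true; false; if_then_else_; _∧_; not)
open import Data.Empty using (⊥-elim)
open import Data.Bool.Properties using (T-≡; ¬-not; ∧-assoc; ∧-zeroʳ; ∧-identityʳ)
open import Function using (_∘_; case_of_; Equivalence)
open import Relation.Binary.Definitions using (tri<; tri≈; tri>)
open import Data.Fin as Fin using (Fin; toℕ; punchIn; _≟_)
import Data.Fin.Properties as Finₚ
open import Data.Maybe using (Maybe; just; nothing)
open import Data.Nat as ℕ using (ℕ; zero; suc; _∸_; _<ᵇ_; _≤ᵇ_)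
import Data.Nat.Properties as ℕₚ
open import Data.Product using (_×_; _,_)
open import Data.Product.Properties using (≡-dec)
open import Data.Sum as Sum using (_⊎_; inj₁; inj₂)
open import Relation.Binary.PropositionalEquality as ≡ using (_≡_; _≢_)
open import Relation.Nullary using (¬_; Dec; yes; no)
open import Relation.Nullary.Decidable using (⌊_⌋; isYes≗does; dec-true; dec-false)
import Algebra.Solver.Ring.AlmostCommutativeRing as ACR
import Algebra.Solver.Ring
open import Relation.Binary.Structures using (IsTotalOrder)

-- The ring solver needs coefficients with decidable equality.  Integers
-- are represented as differences p − n of naturals, kept in the normal
-- form where p or n is zero so that equal integers are equal pairs; the
-- constants 0, 1 and −1 denote 0#, 1# and - 1# on the nose.
module IntegerCoefficientSolver {c ℓ} (R : CommutativeRing c ℓ) where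
  open CommutativeRing R
  open import Algebra.Properties.Monoid.Mult.TCOptimised +-monoid using (×-homo-+)
  open import Algebra.Properties.Semiring.Mult.TCOptimised semiring using (×1-homo-*) renaming (_×_ to _×′_)
  open import Algebra.Properties.Ring ring
    using (-‿distribˡ-*; -‿distribʳ-*; -‿involutive; -‿+-comm; -0#≈0#)
  open import Relation.Binary.Reasoning.Setoid setoid

  Difference : Set
  Difference = ℕ × ℕ

  normalise : ℕ → ℕ → Difference
  normalise p n = p ∸ n , n ∸ p

  coefficients : RawRing _ _
  coefficients = record
    { Carrier = Difference
    ; _≈_     = _≡_
    ; _+_     = λ { (p , n) (p′ , n′) → normalise (p ℕ.+ p′) (n ℕ.+ n′) }
    ; _*_     = λ { (p , n) (p′ , n′) →
                    normalise (p ℕ.* p′ ℕ.+ n ℕ.* n′) (p ℕ.* n′ ℕ.+ n ℕ.* p′) }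
    ; -_      = λ { (p , n) → n , p }
    ; 0#      = 0 , 0
    ; 1#      = 1 , 0
    }

  ι : ℕ → Carrier
  ι n = n ×′ 1#

  ⟦_⟧ : Difference → Carrier
  ⟦ p     , zero  ⟧ = ι p
  ⟦ zero  , suc n ⟧ = - ι (suc n)
  ⟦ suc p , suc n ⟧ = ι (suc p) - ι (suc n)

  ⟦⟧≈ι-ι : ∀ p n → ⟦ p , n ⟧ ≈ ι p - ι n
  ⟦⟧≈ι-ι p       zero    = sym (trans (+-congˡ -0#≈0#) (+-identityʳ _))
  ⟦⟧≈ι-ι zero    (suc n) = sym (+-identityˡ _)
  ⟦⟧≈ι-ι (suc p) (suc n) = refl

  x+y-[x+z]≈y-z : ∀ x y z → (x + y) - (x + z) ≈ y - z
  x+y-[x+z]≈y-z x y z = begin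
    (x + y) + - (x + z)   ≈⟨ +-congˡ (-‿+-comm x z) ⟨
    (x + y) + (- x + - z) ≈⟨ +-assoc x y _ ⟩
    x + (y + (- x + - z)) ≈⟨ +-congˡ (+-assoc y (- x) (- z)) ⟨
    x + ((y + - x) + - z) ≈⟨ +-congˡ (+-congʳ (+-comm y (- x))) ⟩
    x + ((- x + y) + - z) ≈⟨ +-congˡ (+-assoc (- x) y (- z)) ⟩
    x + (- x + (y - z))   ≈⟨ +-assoc x (- x) _ ⟨
    (x - x) + (y - z)     ≈⟨ +-congʳ (-‿inverseʳ x) ⟩
    0# + (y - z)          ≈⟨ +-identityˡ _ ⟩
    y - z                 ∎

  ι[p∸n]-ι[n∸p] : ∀ p n → ι (p ∸ n) - ι (n ∸ p) ≈ ι p - ι n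
  ι[p∸n]-ι[n∸p] zero    zero    = refl
  ι[p∸n]-ι[n∸p] zero    (suc n) = refl
  ι[p∸n]-ι[n∸p] (suc p) zero    = refl
  ι[p∸n]-ι[n∸p] (suc p) (suc n) = begin
    ι (p ∸ n) - ι (n ∸ p)                 ≈⟨ ι[p∸n]-ι[n∸p] p n ⟩
    ι p - ι n                             ≈⟨ x+y-[x+z]≈y-z 1# (ι p) (ι n) ⟨
    (1# + ι p) - (1# + ι n)               ≈⟨ +-cong (×-homo-+ 1# 1 p) (-‿cong (×-homo-+ 1# 1 n)) ⟨
    ι (suc p) - ι (suc n)                 ∎

  ⟦normalise⟧ : ∀ p n → ⟦ normalise p n ⟧ ≈ ι p - ι n
  ⟦normalise⟧ p n = trans (⟦⟧≈ι-ι (p ∸ n) (n ∸ p)) (ι[p∸n]-ι[n∸p] p n)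

  [x-y]+[z-u]≈[x+z]-[y+u] : ∀ x y z u → (x - y) + (z - u) ≈ (x + z) - (y + u)
  [x-y]+[z-u]≈[x+z]-[y+u] x y z u = begin
    (x + - y) + (z + - u) ≈⟨ +-assoc x (- y) _ ⟩
    x + (- y + (z + - u)) ≈⟨ +-congˡ (+-assoc (- y) z (- u)) ⟨
    x + ((- y + z) + - u) ≈⟨ +-congˡ (+-congʳ (+-comm (- y) z)) ⟩
    x + ((z + - y) + - u) ≈⟨ +-congˡ (+-assoc z (- y) (- u)) ⟩
    x + (z + (- y + - u)) ≈⟨ +-assoc x z _ ⟨
    (x + z) + (- y + - u) ≈⟨ +-congˡ (-‿+-comm y u) ⟩
    (x + z) - (y + u)     ∎

  [x-y][z-u]≈[xz+yu]-[xu+yz] : ∀ x y z u → (x - y) * (z - u) ≈ (x * z + y * u) - (x * u + y * z)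
  [x-y][z-u]≈[xz+yu]-[xu+yz] x y z u = begin
    (x - y) * (z - u)                         ≈⟨ distribʳ (z - u) x (- y) ⟩
    x * (z - u) + - y * (z - u)               ≈⟨ +-cong (distribˡ x z (- u)) (distribˡ (- y) z (- u)) ⟩
    (x * z + x * - u) + (- y * z + - y * - u) ≈⟨ +-cong (+-congˡ (sym (-‿distribʳ-* x u)))
                                                        (+-cong (sym (-‿distribˡ-* y z)) -y*-u≈yu) ⟩
    (x * z - x * u) + (- (y * z) + y * u)     ≈⟨ +-congˡ (+-comm _ _) ⟩
    (x * z - x * u) + (y * u - y * z)         ≈⟨ [x-y]+[z-u]≈[x+z]-[y+u] _ _ _ _ ⟩
    (x * z + y * u) - (x * u + y * z)         ∎
    where
    -y*-u≈yu : - y * - u ≈ y * u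
    -y*-u≈yu = trans (sym (-‿distribˡ-* y (- u)))
                     (trans (-‿cong (sym (-‿distribʳ-* y u))) (-‿involutive _))

  morphism : coefficients ACR.-Raw-AlmostCommutative⟶ ACR.fromCommutativeRing R
  morphism = record
    { ⟦_⟧    = ⟦_⟧
    ; +-homo = λ { (p , n) (p′ , n′) → begin
        ⟦ normalise (p ℕ.+ p′) (n ℕ.+ n′) ⟧ ≈⟨ ⟦normalise⟧ (p ℕ.+ p′) (n ℕ.+ n′) ⟩
        ι (p ℕ.+ p′) - ι (n ℕ.+ n′)         ≈⟨ +-cong (×-homo-+ 1# p p′) (-‿cong (×-homo-+ 1# n n′)) ⟩
        (ι p + ι p′) - (ι n + ι n′)         ≈⟨ [x-y]+[z-u]≈[x+z]-[y+u] _ _ _ _ ⟨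
        (ι p - ι n) + (ι p′ - ι n′)         ≈⟨ +-cong (⟦⟧≈ι-ι p n) (⟦⟧≈ι-ι p′ n′) ⟨
        ⟦ p , n ⟧ + ⟦ p′ , n′ ⟧             ∎ }
    ; *-homo = λ { (p , n) (p′ , n′) → begin
        ⟦ normalise (p ℕ.* p′ ℕ.+ n ℕ.* n′) (p ℕ.* n′ ℕ.+ n ℕ.* p′) ⟧
          ≈⟨ ⟦normalise⟧ (p ℕ.* p′ ℕ.+ n ℕ.* n′) (p ℕ.* n′ ℕ.+ n ℕ.* p′) ⟩
        ι (p ℕ.* p′ ℕ.+ n ℕ.* n′) - ι (p ℕ.* n′ ℕ.+ n ℕ.* p′)
          ≈⟨ +-cong (ι-+-* p p′ n n′) (-‿cong (ι-+-* p n′ n p′)) ⟩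
        (ι p * ι p′ + ι n * ι n′) - (ι p * ι n′ + ι n * ι p′)
          ≈⟨ [x-y][z-u]≈[xz+yu]-[xu+yz] _ _ _ _ ⟨
        (ι p - ι n) * (ι p′ - ι n′)
          ≈⟨ *-cong (⟦⟧≈ι-ι p n) (⟦⟧≈ι-ι p′ n′) ⟨
        ⟦ p , n ⟧ * ⟦ p′ , n′ ⟧ ∎ }
    ; -‿homo = λ { (p , n) → begin
        ⟦ n , p ⟧         ≈⟨ ⟦⟧≈ι-ι n p ⟩
        ι n - ι p         ≈⟨ +-comm _ _ ⟩
        - ι p + ι n       ≈⟨ +-congˡ (-‿involutive (ι n)) ⟨
        - ι p + - - ι n   ≈⟨ -‿+-comm _ _ ⟩
        - (ι p - ι n)     ≈⟨ -‿cong (⟦⟧≈ι-ι p n) ⟨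
        - ⟦ p , n ⟧       ∎ }
    ; 0-homo = refl
    ; 1-homo = refl
    }
    where
    ι-+-* : ∀ p q r s → ι (p ℕ.* q ℕ.+ r ℕ.* s) ≈ ι p * ι q + ι r * ι s
    ι-+-* p q r s = trans (×-homo-+ 1# (p ℕ.* q) (r ℕ.* s)) (+-cong (×1-homo-* p q) (×1-homo-* r s))

  decideEquality : ∀ x y → Maybe (⟦ x ⟧ ≈ ⟦ y ⟧)
  decideEquality x y with ≡-dec ℕ._≟_ ℕ._≟_ x y
  ... | yes ≡.refl = just refl
  ... | no _       = nothing

  open Algebra.Solver.Ring coefficients (ACR.fromCommutativeRing R) morphism decideEquality public
    using (solve; _:=_; _:+_; _:*_; :-_; _:-_; con)

-- Defs' `_<F_`, which does not depend on the field.
_≺_ : ∀ {n} → Fin n → Fin n → Bool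
x ≺ y = toℕ x <ᵇ toℕ y

module _ {n : ℕ} where
  ≺⇒< : {x y : Fin n} → (x ≺ y) ≡ true → toℕ x ℕ.< toℕ y
  ≺⇒< {x} {y} x≺y = ℕₚ.<ᵇ⇒< (toℕ x) (toℕ y) (Equivalence.from T-≡ x≺y)

  <⇒≺ : {x y : Fin n} → toℕ x ℕ.< toℕ y → (x ≺ y) ≡ true
  <⇒≺ x<y = Equivalence.to T-≡ (ℕₚ.<⇒<ᵇ x<y)

  ≮⇒≺-false : {x y : Fin n} → ¬ (toℕ x ℕ.< toℕ y) → (x ≺ y) ≡ false
  ≮⇒≺-false {x} {y} x≮y = ¬-not (λ x≺y → x≮y (≺⇒< {x} {y} x≺y))

  ≺-irrefl : (x : Fin n) → (x ≺ x) ≡ false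
  ≺-irrefl x = ≮⇒≺-false {x} {x} (ℕₚ.<-irrefl ≡.refl)

  ≺-trans : {x y z : Fin n} → (x ≺ y) ≡ true → (y ≺ z) ≡ true → (x ≺ z) ≡ true
  ≺-trans {x} {y} {z} x≺y y≺z = <⇒≺ {x} {z} (ℕₚ.<-trans (≺⇒< {x} {y} x≺y) (≺⇒< {y} {z} y≺z))

  ≺-flip : {x y : Fin n} → x ≢ y → (y ≺ x) ≡ not (x ≺ y)
  ≺-flip {x} {y} x≢y with ℕₚ.<-cmp (toℕ x) (toℕ y)
  ... | tri< x<y _ _ rewrite <⇒≺ {x} {y} x<y = ≮⇒≺-false {y} {x} (ℕₚ.<-asym x<y)
  ... | tri≈ _ x≡y _                          = ⊥-elim (x≢y (Finₚ.toℕ-injective x≡y))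
  ... | tri> _ _ y<x rewrite ≮⇒≺-false {x} {y} (ℕₚ.<-asym y<x) = <⇒≺ {y} {x} y<x

  ≺-asym : {x y : Fin n} → (x ≺ y) ≡ true → (y ≺ x) ≡ false
  ≺-asym {x} {y} x≺y = ≮⇒≺-false {y} {x} (ℕₚ.<-asym (≺⇒< {x} {y} x≺y))

≺-punchIn : ∀ {m} (b : Fin (suc m)) (i j : Fin m) → (punchIn b i ≺ punchIn b j) ≡ (i ≺ j)
≺-punchIn Fin.zero    i           j           = ≡.refl
≺-punchIn (Fin.suc b) Fin.zero    Fin.zero    = ≡.refl
≺-punchIn (Fin.suc b) Fin.zero    (Fin.suc j) = ≡.refl
≺-punchIn (Fin.suc b) (Fin.suc i) Fin.zero    = ≡.refl
≺-punchIn (Fin.suc b) (Fin.suc i) (Fin.suc j) = ≺-punchIn b i j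

module _ where
  open import Data.Nat using (_+_)

  -- p, q, r stand for x ≺ y, y ≺ z, x ≺ z; the six summands test the six
  -- arrangements (x,y,z), (y,x,z), (x,z,y), (y,z,x), (z,x,y), (z,y,x).
  oneOfSixOrders : ∀ p q r → (p ≡ true → q ≡ true → r ≡ true) → (p ≡ false → q ≡ false → r ≡ false) →
    boolToℕ (p ∧ q) + boolToℕ (not p ∧ r) + boolToℕ (r ∧ not q) +
    boolToℕ (q ∧ not r) + boolToℕ (not r ∧ p) + boolToℕ (not q ∧ not p) ≡ 1
  oneOfSixOrders true  true  true  _ _ = ≡.refl
  oneOfSixOrders true  true  false h _ with () ← h ≡.refl ≡.refl
  oneOfSixOrders true  false true  _ _ = ≡.refl
  oneOfSixOrders true  false false _ _ = ≡.refl
  oneOfSixOrders false true  true  _ _ = ≡.refl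
  oneOfSixOrders false true  false _ _ = ≡.refl
  oneOfSixOrders false false true  _ h with () ← h ≡.refl ≡.refl
  oneOfSixOrders false false false _ _ = ≡.refl

  sorted : ∀ {n} → Fin n → Fin n → Fin n → Bool
  sorted x y z = (x ≺ y) ∧ (y ≺ z)

  oneSortedArrangement : ∀ {n} {x y z : Fin n} → x ≢ y → y ≢ z → x ≢ z →
    boolToℕ (sorted x y z) + boolToℕ (sorted y x z) + boolToℕ (sorted x z y) +
    boolToℕ (sorted y z x) + boolToℕ (sorted z x y) + boolToℕ (sorted z y x) ≡ 1
  oneSortedArrangement {x = x} {y} {z} x≢y y≢z x≢z
    rewrite ≺-flip x≢y | ≺-flip y≢z | ≺-flip x≢z =
    oneOfSixOrders (x ≺ y) (y ≺ z) (x ≺ z) (≺-trans {x = x} {y} {z})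
      (λ x⊀y y⊀z → ¬-not (λ x≺z → case ≡.trans (≡.sym (≺-trans {x = x} {z} {y} x≺z (z≺y y⊀z))) x⊀y of λ ()))
    where
    z≺y : (y ≺ z) ≡ false → (z ≺ y) ≡ true
    z≺y y⊀z = ≡.trans (≺-flip y≢z) (≡.cong not y⊀z)

  count-∧ʳ : ∀ s₁ s₂ s₃ s₄ s₅ s₆ c →
    (c ≡ true → boolToℕ s₁ + boolToℕ s₂ + boolToℕ s₃ + boolToℕ s₄ + boolToℕ s₅ + boolToℕ s₆ ≡ 1) →
    boolToℕ (s₁ ∧ c) + boolToℕ (s₂ ∧ c) + boolToℕ (s₃ ∧ c) +
    boolToℕ (s₄ ∧ c) + boolToℕ (s₅ ∧ c) + boolToℕ (s₆ ∧ c) ≡ boolToℕ c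
  count-∧ʳ s₁ s₂ s₃ s₄ s₅ s₆ false _
    rewrite ∧-zeroʳ s₁ | ∧-zeroʳ s₂ | ∧-zeroʳ s₃ | ∧-zeroʳ s₄ | ∧-zeroʳ s₅ | ∧-zeroʳ s₆ = ≡.refl
  count-∧ʳ s₁ s₂ s₃ s₄ s₅ s₆ true  h
    rewrite ∧-identityʳ s₁ | ∧-identityʳ s₂ | ∧-identityʳ s₃ |
            ∧-identityʳ s₄ | ∧-identityʳ s₅ | ∧-identityʳ s₆ = h ≡.refl

  module _ {n} (G : SimpleGraph n) where
    atLeastTwoEdges : Fin n → Fin n → Fin n → Bool
    atLeastTwoEdges x y z = 2 ≤ᵇ inducedEdges G x y z

    tripleGuard : Fin n → Fin n → Fin n → Bool
    tripleGuard x y z = (x ≺ y) ∧ ((y ≺ z) ∧ atLeastTwoEdges x y z)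

    atLeastTwoEdges-swap₁₂ : ∀ x y z → atLeastTwoEdges x y z ≡ atLeastTwoEdges y x z
    atLeastTwoEdges-swap₁₂ x y z rewrite adj-sym G y x =
      ≡.cong (2 ≤ᵇ_) (xy∙z≈xz∙y (boolToℕ (adj G x y)) (boolToℕ (adj G x z)) (boolToℕ (adj G y z)))
      where open import Algebra.Properties.CommutativeSemigroup ℕₚ.+-commutativeSemigroup using (xy∙z≈xz∙y)

    atLeastTwoEdges-swap₂₃ : ∀ x y z → atLeastTwoEdges x y z ≡ atLeastTwoEdges x z y
    atLeastTwoEdges-swap₂₃ x y z rewrite adj-sym G z y =
      ≡.cong (λ k → 2 ≤ᵇ k + boolToℕ (adj G y z)) (ℕₚ.+-comm (boolToℕ (adj G x y)) (boolToℕ (adj G x z)))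

    atLeastTwoEdges-nonadjacent : ∀ {x y} z → adj G x y ≡ false →
                                  atLeastTwoEdges x y z ≡ adj G x z ∧ adj G y z
    atLeastTwoEdges-nonadjacent {x} {y} z x≁y rewrite x≁y with adj G x z | adj G y z
    ... | true  | true  = ≡.refl
    ... | true  | false = ≡.refl
    ... | false | true  = ≡.refl
    ... | false | false = ≡.refl

    edgeGuard : Fin n → Fin n → Bool
    edgeGuard x y = (x ≺ y) ∧ adj G x y

    edgeGuard-irrefl : ∀ x → edgeGuard x x ≡ false
    edgeGuard-irrefl x rewrite ≺-irrefl x = ≡.refl

    edgeGuard-nonadjacent : ∀ {x y} → adj G x y ≡ false → edgeGuard x y ≡ false
    edgeGuard-nonadjacent {x} {y} x≁y rewrite x≁y = ∧-zeroʳ (x ≺ y)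

    tripleGuard-repeat₁₂ : ∀ x z → tripleGuard x x z ≡ false
    tripleGuard-repeat₁₂ x z rewrite ≺-irrefl x = ≡.refl

    tripleGuard-repeat₂₃ : ∀ x y → tripleGuard x y y ≡ false
    tripleGuard-repeat₂₃ x y rewrite ≺-irrefl y = ∧-zeroʳ (x ≺ y)

    tripleGuard-repeat₁₃ : ∀ x y → tripleGuard x y x ≡ false
    tripleGuard-repeat₁₃ x y with x ≺ y in x≺y
    ... | false = ≡.refl
    ... | true rewrite ≺-asym {x = x} {y} x≺y = ≡.refl

    adjacent⇒≢ : ∀ {x y} → adj G x y ≡ true → x ≢ y
    adjacent⇒≢ {x} x∼y ≡.refl with () ← ≡.trans (≡.sym x∼y) (irrefl G x)

    module _ {a b} (a≢b : a ≢ b) (a≁b : adj G a b ≡ false) (z : Fin n) where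
      tripleGuard≡sorted∧common : ∀ x y w → atLeastTwoEdges x y w ≡ atLeastTwoEdges a b z →
                                  tripleGuard x y w ≡ sorted x y w ∧ (adj G a z ∧ adj G b z)
      tripleGuard≡sorted∧common x y w eq = ≡.trans (≡.sym (∧-assoc (x ≺ y) (y ≺ w) _))
        (≡.cong (sorted x y w ∧_) (≡.trans eq (atLeastTwoEdges-nonadjacent z a≁b)))

      -- Exactly one arrangement of a, b, z is sorted, and as {a, b} is not an
      -- edge its triple has two edges iff z is adjacent to both a and b.
      arrangementsOfNonEdge :
        boolToℕ (tripleGuard a b z) + boolToℕ (tripleGuard b a z) + boolToℕ (tripleGuard a z b) +
        boolToℕ (tripleGuard b z a) + boolToℕ (tripleGuard z a b) + boolToℕ (tripleGuard z b a)
        ≡ boolToℕ (adj G a z ∧ adj G b z)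
      arrangementsOfNonEdge
        rewrite tripleGuard≡sorted∧common a b z ≡.refl
              | tripleGuard≡sorted∧common b a z (≡.sym (atLeastTwoEdges-swap₁₂ a b z))
              | tripleGuard≡sorted∧common a z b (≡.sym (atLeastTwoEdges-swap₂₃ a b z))
              | tripleGuard≡sorted∧common b z a
                  (≡.trans (atLeastTwoEdges-swap₂₃ b z a) (≡.sym (atLeastTwoEdges-swap₁₂ a b z)))
              | tripleGuard≡sorted∧common z a b
                  (≡.trans (atLeastTwoEdges-swap₁₂ z a b) (≡.sym (atLeastTwoEdges-swap₂₃ a b z)))
              | tripleGuard≡sorted∧common z b a
                  (≡.trans (atLeastTwoEdges-swap₁₂ z b a)
                  (≡.trans (atLeastTwoEdges-swap₂₃ b z a) (≡.sym (atLeastTwoEdges-swap₁₂ a b z))))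
        = count-∧ʳ (sorted a b z) (sorted b a z) (sorted a z b) (sorted b z a) (sorted z a b) (sorted z b a)
                 (adj G a z ∧ adj G b z) common⇒one
        where
        common⇒one : adj G a z ∧ adj G b z ≡ true → _
        common⇒one common with adj G a z in a∼z | adj G b z in b∼z
        common⇒one ≡.refl | true | true = oneSortedArrangement a≢b (adjacent⇒≢ b∼z) (adjacent⇒≢ a∼z)

  module _ {m} (G : SimpleGraph (suc m)) (b : Fin (suc m)) (i j : Fin m) where
    edgeGuard-punchIn : edgeGuard (deleteVertex b G) i j ≡ edgeGuard G (punchIn b i) (punchIn b j)
    edgeGuard-punchIn = ≡.cong (_∧ adj G (punchIn b i) (punchIn b j)) (≡.sym (≺-punchIn b i j))

    tripleGuard-punchIn : ∀ k → tripleGuard (deleteVertex b G) i j k ≡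
                                tripleGuard G (punchIn b i) (punchIn b j) (punchIn b k)
    tripleGuard-punchIn k rewrite ≺-punchIn b i j | ≺-punchIn b j k = ≡.refl

module LBFProperties {c ℓ₁ ℓ₂} (F : OrderedField c ℓ₁ ℓ₂) where
  open OrderedField F
  open IntegerCoefficientSolver commutativeRing using (solve; _:=_; _:+_; _:*_; :-_; _:-_; con)
  open import Algebra.Properties.Ring ring using (-0#≈0#)
  open import Algebra.Properties.CommutativeMonoid.Sum +-commutativeMonoid
    using (sum; sum-syntax; sum-cong-≋; sum-replicate-zero; sum-remove; ∑-distrib-+; ∑-comm)
  open import Algebra.Properties.Semiring.Sum semiring using (*-distribˡ-sum)
  open import Algebra.Properties.Monoid.Mult.TCOptimised +-monoid using (×-homo-+)
    renaming (_×_ to _×′_)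
  open IsTotalOrder isTotalOrder using (total; antisym; ≤-respˡ-≈; ≤-respʳ-≈)
    renaming (refl to ≤-refl; trans to ≤-trans)
  open import Relation.Binary.Reasoning.Setoid setoid

  ≤-resp-≈ : ∀ {x x′ y y′} → x ≈ x′ → y ≈ y′ → x ≤ y → x′ ≤ y′
  ≤-resp-≈ x≈x′ y≈y′ x≤y = ≤-respˡ-≈ x≈x′ (≤-respʳ-≈ y≈y′ x≤y)

  +-monoʳ-≤ : ∀ {x y} z → x ≤ y → (z + x) ≤ (z + y)
  +-monoʳ-≤ {x} {y} z x≤y = ≤-resp-≈ (+-comm x z) (+-comm y z) (+-monoˡ-≤ z x≤y)

  x≤x+y : ∀ x {y} → 0# ≤ y → x ≤ (x + y)
  x≤x+y x 0≤y = ≤-respˡ-≈ (+-identityʳ x) (+-monoʳ-≤ x 0≤y)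

  x≤y⇒0≤y-x : ∀ {x y} → x ≤ y → 0# ≤ (y - x)
  x≤y⇒0≤y-x {x} x≤y = ≤-respˡ-≈ (-‿inverseʳ x) (+-monoˡ-≤ (- x) x≤y)

  x≤0⇒0≤-x : ∀ {x} → x ≤ 0# → 0# ≤ (- x)
  x≤0⇒0≤-x {x} x≤0 = ≤-resp-≈ (-‿inverseʳ x) (+-identityˡ (- x)) (+-monoˡ-≤ (- x) x≤0)

  +-nonneg : ∀ {x y} → 0# ≤ x → 0# ≤ y → 0# ≤ (x + y)
  +-nonneg {x} {y} 0≤x 0≤y = ≤-trans 0≤y (≤-respˡ-≈ (+-identityˡ y) (+-monoˡ-≤ y 0≤x))

  x*x-nonneg : ∀ x → 0# ≤ (x * x)
  x*x-nonneg x with total 0# x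
  ... | inj₁ 0≤x = *-nonneg 0≤x 0≤x
  ... | inj₂ x≤0 = ≤-respʳ-≈ (solve 1 (λ x → (:- x) :* (:- x) := x :* x) refl x)
                              (*-nonneg (x≤0⇒0≤-x x≤0) (x≤0⇒0≤-x x≤0))

  0≤1 : 0# ≤ 1#
  0≤1 = ≤-respʳ-≈ (*-identityˡ 1#) (x*x-nonneg 1#)

  half-nonneg : ∀ {h} → h + h ≈ 1# → 0# ≤ h
  half-nonneg {h} h+h≈1 with total 0# h
  ... | inj₁ 0≤h = 0≤h
  ... | inj₂ h≤0 = ⊥-elim (0≉1 (antisym 0≤1 1≤0))
    where
    1≤0 : 1# ≤ 0#
    1≤0 = ≤-resp-≈ h+h≈1 (+-identityˡ 0#) (≤-trans (+-monoˡ-≤ h h≤0) (+-monoʳ-≤ 0# h≤0))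

  0≤-x*y : ∀ {x y} → 0# ≤ x → y ≤ 0# → 0# ≤ ((- x) * y)
  0≤-x*y {x} {y} 0≤x y≤0 =
    ≤-respʳ-≈ (solve 2 (λ x y → x :* (:- y) := (:- x) :* y) refl x y) (*-nonneg 0≤x (x≤0⇒0≤-x y≤0))

  0≤τ[β+τα] : ∀ {τ β α} → 0# ≤ (τ * β) → 0# ≤ α → 0# ≤ (τ * (β + τ * α))
  0≤τ[β+τα] {τ} {β} {α} 0≤τβ 0≤α =
    ≤-respʳ-≈ (solve 3 (λ τ β α → τ :* β :+ τ :* τ :* α := τ :* (β :+ τ :* α)) refl τ β α)
              (+-nonneg 0≤τβ (*-nonneg (x*x-nonneg τ) 0≤α))

  x≈0⇒x*y≈0 : ∀ {x} y → x ≈ 0# → x * y ≈ 0#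
  x≈0⇒x*y≈0 y x≈0 = trans (*-congʳ x≈0) (zeroˡ y)

  y≈0⇒x*y≈0 : ∀ x {y} → y ≈ 0# → x * y ≈ 0#
  y≈0⇒x*y≈0 x y≈0 = trans (*-congˡ y≈0) (zeroʳ x)

  x≈0⇒y≈0⇒x+y≈0 : ∀ {x y} → x ≈ 0# → y ≈ 0# → x + y ≈ 0#
  x≈0⇒y≈0⇒x+y≈0 x≈0 y≈0 = trans (+-cong x≈0 y≈0) (+-identityʳ 0#)

  x≈0⇒y≈0⇒x-y≈0 : ∀ {x y} → x ≈ 0# → y ≈ 0# → x - y ≈ 0#
  x≈0⇒y≈0⇒x-y≈0 x≈0 y≈0 = x≈0⇒y≈0⇒x+y≈0 x≈0 (trans (-‿cong y≈0) -0#≈0#)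

  [p-q]-[r-s]≈-[q+r] : ∀ {p s} q r → p ≈ 0# → s ≈ 0# → (p - q) - (r - s) ≈ - (q + r)
  [p-q]-[r-s]≈-[q+r] q r p≈0 s≈0 = trans (+-cong (+-congʳ p≈0) (-‿cong (+-congˡ (-‿cong s≈0))))
    (solve 2 (λ q r → (con (0 , 0) :- q) :- (r :- con (0 , 0)) := :- (q :+ r)) refl q r)

  [p-q]-[r-s]≈0 : ∀ {p q r s} → p ≈ 0# → q ≈ 0# → r ≈ 0# → s ≈ 0# → (p - q) - (r - s) ≈ 0#
  [p-q]-[r-s]≈0 p≈0 q≈0 r≈0 s≈0 = trans ([p-q]-[r-s]≈-[q+r] _ _ p≈0 s≈0)
    (trans (-‿cong (trans (+-cong q≈0 r≈0) (+-identityʳ 0#))) -0#≈0#)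

  𝟙 : Bool → Carrier
  𝟙 b = boolToℕ b ×′ 1#

  if≈𝟙* : ∀ b t → (if b then t else 0#) ≈ 𝟙 b * t
  if≈𝟙* true  t = sym (*-identityˡ t)
  if≈𝟙* false t = sym (zeroˡ t)

  𝟙-false : ∀ {c} → c ≡ false → 𝟙 c ≈ 0#
  𝟙-false c≡false = reflexive (≡.cong 𝟙 c≡false)

  𝟙-sum₆ : ∀ b₁ b₂ b₃ b₄ b₅ b₆ {c} →
    boolToℕ b₁ ℕ.+ boolToℕ b₂ ℕ.+ boolToℕ b₃ ℕ.+ boolToℕ b₄ ℕ.+ boolToℕ b₅ ℕ.+ boolToℕ b₆ ≡ boolToℕ c →
    𝟙 b₁ + 𝟙 b₂ + 𝟙 b₃ + 𝟙 b₄ + 𝟙 b₅ + 𝟙 b₆ ≈ 𝟙 c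
  𝟙-sum₆ b₁ b₂ b₃ b₄ b₅ b₆ count = trans (sym
    (trans (×-homo-+ 1# (n₁ ℕ.+ n₂ ℕ.+ n₃ ℕ.+ n₄ ℕ.+ n₅) n₆) (+-congʳ
    (trans (×-homo-+ 1# (n₁ ℕ.+ n₂ ℕ.+ n₃ ℕ.+ n₄) n₅) (+-congʳ
    (trans (×-homo-+ 1# (n₁ ℕ.+ n₂ ℕ.+ n₃) n₄) (+-congʳ
    (trans (×-homo-+ 1# (n₁ ℕ.+ n₂) n₃) (+-congʳ
    (×-homo-+ 1# n₁ n₂))))))))))
    (reflexive (≡.cong (_×′ 1#) count))
    where
    n₁ = boolToℕ b₁; n₂ = boolToℕ b₂; n₃ = boolToℕ b₃
    n₄ = boolToℕ b₄; n₅ = boolToℕ b₅; n₆ = boolToℕ b₆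

  𝟙-nonneg : ∀ b → 0# ≤ 𝟙 b
  𝟙-nonneg false = ≤-refl
  𝟙-nonneg true  = 0≤1

  𝟙-split : ∀ p q → 𝟙 p ≈ 𝟙 (p ∧ not q) + 𝟙 (p ∧ q)
  𝟙-split false q     = sym (+-identityˡ 0#)
  𝟙-split true  false = sym (+-identityʳ 1#)
  𝟙-split true  true  = sym (+-identityˡ 1#)

  𝟙-split′ : ∀ p q → 𝟙 q ≈ 𝟙 (not p ∧ q) + 𝟙 (p ∧ q)
  𝟙-split′ false q = sym (+-identityʳ (𝟙 q))
  𝟙-split′ true  q = sym (+-identityˡ (𝟙 q))

  𝟙-exclusive≤ : ∀ p q {t} → 0# ≤ t → (𝟙 (p ∧ not q) * t + 𝟙 (not p ∧ q) * t) ≤ t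
  𝟙-exclusive≤ true  true  {t} 0≤t = ≤-respˡ-≈ (sym (x≈0⇒y≈0⇒x+y≈0 (zeroˡ t) (zeroˡ t))) 0≤t
  𝟙-exclusive≤ true  false {t} _   =
    ≤-respˡ-≈ (sym (trans (+-cong (*-identityˡ t) (zeroˡ t)) (+-identityʳ t))) ≤-refl
  𝟙-exclusive≤ false true  {t} _   =
    ≤-respˡ-≈ (sym (trans (+-cong (zeroˡ t) (*-identityˡ t)) (+-identityˡ t))) ≤-refl
  𝟙-exclusive≤ false false {t} 0≤t = ≤-respˡ-≈ (sym (x≈0⇒y≈0⇒x+y≈0 (zeroˡ t) (zeroˡ t))) 0≤t

  𝟙*-zero : ∀ b {t} → t ≈ 0# → 𝟙 b * t ≈ 0#
  𝟙*-zero b t≈0 = trans (*-congˡ t≈0) (zeroʳ (𝟙 b))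

  𝟙*-linear : ∀ b τ f g → 𝟙 b * (f + τ * g) ≈ 𝟙 b * f + τ * (𝟙 b * g)
  𝟙*-linear b τ f g = solve 4 (λ e τ f g → e :* (f :+ τ :* g) := e :* f :+ τ :* (e :* g)) refl (𝟙 b) τ f g

  sumFin≡sum : ∀ n (f : Fin n → Carrier) → sumFin F n f ≡ sum f
  sumFin≡sum zero    f = ≡.refl
  sumFin≡sum (suc n) f = ≡.cong (f Fin.zero +_) (sumFin≡sum n (λ i → f (Fin.suc i)))

  ∑-zero : ∀ {n} {f : Fin n → Carrier} → (∀ i → f i ≈ 0#) → sum f ≈ 0#
  ∑-zero {n} f≈0 = trans (sum-cong-≋ f≈0) (sum-replicate-zero n)

  ∑-neg : ∀ {n} (f : Fin n → Carrier) → ∑[ i < n ] (- f i) ≈ - sum f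
  ∑-neg f = begin
    sum (λ i → - f i)        ≈⟨ sum-cong-≋ (λ i → -1*x≈-x (f i)) ⟨
    sum (λ i → - 1# * f i)   ≈⟨ *-distribˡ-sum (- 1#) f ⟨
    - 1# * sum f             ≈⟨ -1*x≈-x (sum f) ⟩
    - sum f                  ∎
    where open import Algebra.Properties.Ring ring using (-1*x≈-x)

  ∑-mono : ∀ {n} {f g : Fin n → Carrier} → (∀ i → f i ≤ g i) → sum f ≤ sum g
  ∑-mono {zero}  _   = ≤-refl
  ∑-mono {suc n} f≤g = ≤-trans (+-monoˡ-≤ _ (f≤g Fin.zero)) (+-monoʳ-≤ _ (∑-mono (λ i → f≤g (Fin.suc i))))

  ∑-nonneg : ∀ {n} {f : Fin n → Carrier} → (∀ i → 0# ≤ f i) → 0# ≤ sum f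
  ∑-nonneg {n} 0≤f = ≤-respˡ-≈ (sum-replicate-zero n) (∑-mono 0≤f)

  ∑-punchIn : ∀ {m} (b : Fin (suc m)) (f : Fin (suc m) → Carrier) →
              f b ≈ 0# → sum f ≈ ∑[ i < m ] f (punchIn b i)
  ∑-punchIn b f fb≈0 = trans (sum-remove f) (trans (+-congʳ fb≈0) (+-identityˡ _))

  ∑-sub : ∀ {n} (f g : Fin n → Carrier) → ∑[ i < n ] (f i - g i) ≈ sum f - sum g
  ∑-sub f g = trans (∑-distrib-+ f (λ i → - g i)) (+-congˡ (∑-neg g))

  ∑-pull₂ : ∀ {n} p q (g : Fin n → Carrier) → ∑[ i < n ] (p * (q * g i)) ≈ p * (q * sum g)
  ∑-pull₂ p q g = trans (sym (*-distribˡ-sum p (λ i → q * g i))) (*-congˡ (sym (*-distribˡ-sum q g)))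

  δ : ∀ {n} → Fin n → Fin n → Carrier
  δ a x = 𝟙 ⌊ x ≟ a ⌋

  δ-self : ∀ {n} (a : Fin n) → δ a a ≈ 1#
  δ-self a = reflexive (≡.cong 𝟙 (≡.trans (isYes≗does (a ≟ a)) (dec-true (a ≟ a) ≡.refl)))

  δ-other : ∀ {n} {a x : Fin n} → x ≢ a → δ a x ≈ 0#
  δ-other {a = a} {x} x≢a = reflexive (≡.cong 𝟙 (≡.trans (isYes≗does (x ≟ a)) (dec-false (x ≟ a) x≢a)))

  ∑-δ : ∀ {n} (a : Fin n) (f : Fin n → Carrier) → ∑[ x < n ] (δ a x * f x) ≈ f a
  ∑-δ {suc m} a f = begin
    sum (λ x → δ a x * f x)                              ≈⟨ sum-remove (λ x → δ a x * f x) ⟩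
    δ a a * f a + ∑[ i < m ] (δ a (punchIn a i) * f (punchIn a i))
      ≈⟨ +-cong (*-congʳ (δ-self a))
                (∑-zero λ i → x≈0⇒x*y≈0 (f (punchIn a i)) (δ-other (Finₚ.punchInᵢ≢i a i))) ⟩
    1# * f a + 0#                                        ≈⟨ trans (+-identityʳ _) (*-identityˡ (f a)) ⟩
    f a                                                  ∎

  Linear : ∀ {I : Set} → ((I → Carrier) → Carrier) → Set _
  Linear {I} S = ∀ τ (f g : I → Carrier) → S (λ i → f i + τ * g i) ≈ S f + τ * S g

  ∑-linear : ∀ {n} → Linear (sum {n})
  ∑-linear τ f g = trans (∑-distrib-+ f (λ i → τ * g i)) (+-congˡ (sym (*-distribˡ-sum τ g)))

  module _ {I : Set} {S : (I → Carrier) → Carrier} (S-linear : Linear S) where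
    Linear⇒quadratic : ∀ τ (A B C : I → Carrier) →
      S (λ i → A i + τ * (B i + τ * C i)) ≈ S A + τ * (S B + τ * S C)
    Linear⇒quadratic τ A B C = trans (S-linear τ A _) (+-congˡ (*-congˡ (S-linear τ B C)))

    Linear⇒cubic : ∀ τ (A B C D : I → Carrier) →
      S (λ i → A i + τ * (B i + τ * (C i + τ * D i))) ≈ S A + τ * (S B + τ * (S C + τ * S D))
    Linear⇒cubic τ A B C D = trans (S-linear τ A _) (+-congˡ (*-congˡ (Linear⇒quadratic τ B C D)))

  -- Sums over edges and over triples with at least two edges

  module _ {n} (G : SimpleGraph n) where
    edgeSum : (Fin n × Fin n → Carrier) → Carrier
    edgeSum f = ∑[ x < n ] ∑[ y < n ] (𝟙 (edgeGuard G x y) * f (x , y))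

    tripleSum : (Fin n × Fin n × Fin n → Carrier) → Carrier
    tripleSum f = ∑[ x < n ] ∑[ y < n ] ∑[ z < n ] (𝟙 (tripleGuard G x y z) * f (x , y , z))

    edgeSum-cong : ∀ {f g} → (∀ x y → f (x , y) ≈ g (x , y)) → edgeSum f ≈ edgeSum g
    edgeSum-cong f≈g = sum-cong-≋ λ x → sum-cong-≋ λ y → *-congˡ (f≈g x y)

    tripleSum-cong : ∀ {f g} → (∀ x y z → f (x , y , z) ≈ g (x , y , z)) → tripleSum f ≈ tripleSum g
    tripleSum-cong f≈g = sum-cong-≋ λ x → sum-cong-≋ λ y → sum-cong-≋ λ z → *-congˡ (f≈g x y z)

    edgeSum-linear : Linear edgeSum
    edgeSum-linear τ f g =
      trans (sum-cong-≋ λ x → trans (sum-cong-≋ λ y → 𝟙*-linear (edgeGuard G x y) τ _ _) (∑-linear {n} τ _ _))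
            (∑-linear {n} τ _ _)

    tripleSum-linear : Linear tripleSum
    tripleSum-linear τ f g =
      trans (sum-cong-≋ λ x → trans (sum-cong-≋ λ y →
               trans (sum-cong-≋ λ z → 𝟙*-linear (tripleGuard G x y z) τ _ _) (∑-linear {n} τ _ _))
             (∑-linear {n} τ _ _))
            (∑-linear {n} τ _ _)

    edgeSum-+ : ∀ f g → edgeSum (λ i → f i + g i) ≈ edgeSum f + edgeSum g
    edgeSum-+ f g =
      trans (sum-cong-≋ λ x → trans (sum-cong-≋ λ y → distribˡ (𝟙 (edgeGuard G x y)) _ _)
                                    (∑-distrib-+ {n} _ _))
            (∑-distrib-+ {n} _ _)

    tripleSum-+ : ∀ f g → tripleSum (λ i → f i + g i) ≈ tripleSum f + tripleSum g
    tripleSum-+ f g =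
      trans (sum-cong-≋ λ x → trans (sum-cong-≋ λ y →
               trans (sum-cong-≋ λ z → distribˡ (𝟙 (tripleGuard G x y z)) _ _) (∑-distrib-+ {n} _ _))
             (∑-distrib-+ {n} _ _))
            (∑-distrib-+ {n} _ _)

    𝟙-edgeGuard-sym : ∀ x y → 𝟙 (edgeGuard G x y) + 𝟙 (edgeGuard G y x) ≈ 𝟙 (adj G x y)
    𝟙-edgeGuard-sym x y rewrite adj-sym G y x with adj G x y in x∼y
    ... | false rewrite ∧-zeroʳ (x ≺ y) | ∧-zeroʳ (y ≺ x) = +-identityˡ 0#
    ... | true rewrite ∧-identityʳ (x ≺ y) | ∧-identityʳ (y ≺ x) | ≺-flip (adjacent⇒≢ G x∼y) with x ≺ y
    ...   | true  = +-identityʳ 1#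
    ...   | false = +-identityˡ 1#

    edgeSum-symmetrise : ∀ (K : Fin n → Fin n → Carrier) →
      edgeSum (λ (x , y) → K x y + K y x) ≈ ∑[ x < n ] ∑[ y < n ] (𝟙 (adj G x y) * K x y)
    edgeSum-symmetrise K = begin
      edgeSum (λ (x , y) → K x y + K y x)
        ≈⟨ edgeSum-+ (λ (x , y) → K x y) (λ (x , y) → K y x) ⟩
      edgeSum (λ (x , y) → K x y) + ∑[ x < n ] ∑[ y < n ] (𝟙 (edgeGuard G x y) * K y x)
        ≈⟨ +-congˡ (∑-comm (λ x y → 𝟙 (edgeGuard G x y) * K y x)) ⟩
      edgeSum (λ (x , y) → K x y) + ∑[ x < n ] ∑[ y < n ] (𝟙 (edgeGuard G y x) * K x y)
        ≈⟨ ∑-distrib-+ {n} _ _ ⟨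
      ∑[ x < n ] (∑[ y < n ] (𝟙 (edgeGuard G x y) * K x y) + ∑[ y < n ] (𝟙 (edgeGuard G y x) * K x y))
        ≈⟨ sum-cong-≋ {n} (λ x → ∑-distrib-+ (λ y → 𝟙 (edgeGuard G x y) * K x y)
                                             (λ y → 𝟙 (edgeGuard G y x) * K x y)) ⟨
      ∑[ x < n ] ∑[ y < n ] (𝟙 (edgeGuard G x y) * K x y + 𝟙 (edgeGuard G y x) * K x y)
        ≈⟨ sum-cong-≋ (λ x → sum-cong-≋ λ y →
             trans (sym (distribʳ (K x y) _ _)) (*-congʳ (𝟙-edgeGuard-sym x y))) ⟩
      ∑[ x < n ] ∑[ y < n ] (𝟙 (adj G x y) * K x y) ∎

    sumEdges≈edgeSum : ∀ f → sumEdges F G f ≈ edgeSum (λ (x , y) → f x y)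
    sumEdges≈edgeSum f = trans (reflexive (sumFin≡sum n _)) (sum-cong-≋ λ x →
      trans (reflexive (sumFin≡sum n _)) (sum-cong-≋ λ y → if-if x y))
      where
      if-if : ∀ x y → (if x ≺ y then (if adj G x y then f x y else 0#) else 0#) ≈ 𝟙 (edgeGuard G x y) * f x y
      if-if x y with x ≺ y
      ... | true  = if≈𝟙* (adj G x y) (f x y)
      ... | false = sym (zeroˡ _)

    sumE≈tripleSum : ∀ f → sumE F G f ≈ tripleSum (λ (x , y , z) → f x y z)
    sumE≈tripleSum f = trans (reflexive (sumFin≡sum n _)) (sum-cong-≋ λ x →
      trans (reflexive (sumFin≡sum n _)) (sum-cong-≋ λ y →
      trans (reflexive (sumFin≡sum n _)) (sum-cong-≋ λ z → if-if-if x y z)))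
      where
      if-if-if : ∀ x y z →
        (if x ≺ y then (if y ≺ z then (if atLeastTwoEdges G x y z then f x y z else 0#) else 0#) else 0#)
        ≈ 𝟙 (tripleGuard G x y z) * f x y z
      if-if-if x y z with x ≺ y | y ≺ z
      ... | true  | true  = if≈𝟙* (atLeastTwoEdges G x y z) (f x y z)
      ... | true  | false = sym (zeroˡ _)
      ... | false | _     = sym (zeroˡ _)

  module _ {m} (G : SimpleGraph (suc m)) (b : Fin (suc m)) where
    private
      G-b = deleteVertex b G
      pI = punchIn b

    edgeSum-punchIn : ∀ {f} → (∀ y → f (b , y) ≈ 0#) → (∀ x → f (x , b) ≈ 0#) →
                      edgeSum G f ≈ edgeSum G-b (λ (i , j) → f (pI i , pI j))
    edgeSum-punchIn {f} f[b,_]≈0 f[_,b]≈0 =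
      trans (∑-punchIn b (λ x → ∑[ y < suc m ] (𝟙 (edgeGuard G x y) * f (x , y)))
                         (∑-zero λ y → 𝟙*-zero (edgeGuard G b y) (f[b,_]≈0 y))) (sum-cong-≋ λ i →
      trans (∑-punchIn b (λ y → 𝟙 (edgeGuard G (pI i) y) * f (pI i , y))
                         (𝟙*-zero (edgeGuard G (pI i) b) (f[_,b]≈0 (pI i)))) (sum-cong-≋ λ j →
      *-congʳ (reflexive (≡.cong 𝟙 (≡.sym (edgeGuard-punchIn G b i j))))))

    tripleSum-punchIn : ∀ {f} → (∀ y z → f (b , y , z) ≈ 0#) → (∀ x z → f (x , b , z) ≈ 0#) →
                        (∀ x y → f (x , y , b) ≈ 0#) →
                        tripleSum G f ≈ tripleSum G-b (λ (i , j , k) → f (pI i , pI j , pI k))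
    tripleSum-punchIn {f} f[b,_,_]≈0 f[_,b,_]≈0 f[_,_,b]≈0 =
      trans (∑-punchIn b (λ x → ∑[ y < suc m ] ∑[ z < suc m ] (𝟙 (tripleGuard G x y z) * f (x , y , z)))
                         (∑-zero λ y → ∑-zero λ z → 𝟙*-zero (tripleGuard G b y z) (f[b,_,_]≈0 y z)))
      (sum-cong-≋ λ i →
      trans (∑-punchIn b (λ y → ∑[ z < suc m ] (𝟙 (tripleGuard G (pI i) y z) * f (pI i , y , z)))
                         (∑-zero λ z → 𝟙*-zero (tripleGuard G (pI i) b z) (f[_,b,_]≈0 (pI i) z)))
      (sum-cong-≋ λ j →
      trans (∑-punchIn b (λ z → 𝟙 (tripleGuard G (pI i) (pI j) z) * f (pI i , pI j , z))
                         (𝟙*-zero (tripleGuard G (pI i) (pI j) b) (f[_,_,b]≈0 (pI i) (pI j))))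
      (sum-cong-≋ λ k →
      *-congʳ (reflexive (≡.cong 𝟙 (≡.sym (tripleGuard-punchIn G b i j k)))))))

  ℓ : Carrier → Carrier → Carrier → Carrier → Carrier
  ℓ h T S D = T + h * S - h * (D * D)

  ℓ-cong : ∀ h {T T′ S S′ D D′} → T ≈ T′ → S ≈ S′ → D ≈ D′ → ℓ h T S D ≈ ℓ h T′ S′ D′
  ℓ-cong h T≈T′ S≈S′ D≈D′ = +-cong (+-cong T≈T′ (*-congˡ S≈S′)) (-‿cong (*-congˡ (*-cong D≈D′ D≈D′)))

  module _ {n} (H : SimpleGraph n) (v : Fin n → Carrier) where
    T₃ E₃ E₂ : Carrier
    T₃ = tripleSum H (λ (x , y , z) → v x * v y * v z)
    E₃ = edgeSum H (λ (x , y) → v x * v x * v y + v x * v y * v y)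
    E₂ = edgeSum H (λ (x , y) → v x * v y)

    LBF≈ℓ : ∀ h → LBF F h H v ≈ ℓ h T₃ E₃ E₂
    LBF≈ℓ h = ℓ-cong h (sumE≈tripleSum H _) (sumEdges≈edgeSum H _) (sumEdges≈edgeSum H _)

  LBF-cong : ∀ h {n} (H : SimpleGraph n) {v v′ : Fin n → Carrier} → (∀ x → v x ≈ v′ x) →
             LBF F h H v ≈ LBF F h H v′
  LBF-cong h H {v} {v′} v≈v′ = begin
    LBF F h H v                        ≈⟨ LBF≈ℓ H v h ⟩
    ℓ h (T₃ H v) (E₃ H v) (E₂ H v)     ≈⟨ ℓ-cong h
      (tripleSum-cong H λ x y z → *-cong (*-cong (v≈v′ x) (v≈v′ y)) (v≈v′ z))
      (edgeSum-cong H λ x y → +-cong (*-cong (*-cong (v≈v′ x) (v≈v′ x)) (v≈v′ y))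
                                     (*-cong (*-cong (v≈v′ x) (v≈v′ y)) (v≈v′ y)))
      (edgeSum-cong H λ x y → *-cong (v≈v′ x) (v≈v′ y)) ⟩
    ℓ h (T₃ H v′) (E₃ H v′) (E₂ H v′)  ≈⟨ LBF≈ℓ H v′ h ⟨
    LBF F h H v′                       ∎

  LBF-punchIn : ∀ h {m} (G : SimpleGraph (suc m)) (b : Fin (suc m)) {u : Fin (suc m) → Carrier} →
                u b ≈ 0# → LBF F h G u ≈ LBF F h (deleteVertex b G) (λ i → u (punchIn b i))
  LBF-punchIn h G b {u} ub≈0 = begin
    LBF F h G u                              ≈⟨ LBF≈ℓ G u h ⟩
    ℓ h (T₃ G u) (E₃ G u) (E₂ G u)           ≈⟨ ℓ-cong h
      (tripleSum-punchIn G b {λ (x , y , z) → u x * u y * u z}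
         (λ y z → x≈0⇒x*y≈0 (u z) (x≈0⇒x*y≈0 (u y) ub≈0))
         (λ x z → x≈0⇒x*y≈0 (u z) (y≈0⇒x*y≈0 (u x) ub≈0))
         (λ x y → y≈0⇒x*y≈0 (u x * u y) ub≈0))
      (edgeSum-punchIn G b {λ (x , y) → u x * u x * u y + u x * u y * u y}
         (λ y → x≈0⇒y≈0⇒x+y≈0 (x≈0⇒x*y≈0 (u y) (x≈0⇒x*y≈0 (u b) ub≈0))
                               (x≈0⇒x*y≈0 (u y) (x≈0⇒x*y≈0 (u y) ub≈0)))
         (λ x → x≈0⇒y≈0⇒x+y≈0 (y≈0⇒x*y≈0 (u x * u x) ub≈0) (y≈0⇒x*y≈0 (u x * u b) ub≈0)))
      (edgeSum-punchIn G b {λ (x , y) → u x * u y}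
         (λ y → x≈0⇒x*y≈0 (u y) ub≈0) (λ x → y≈0⇒x*y≈0 (u x) ub≈0)) ⟩
    ℓ h (T₃ G-b uI) (E₃ G-b uI) (E₂ G-b uI)  ≈⟨ LBF≈ℓ G-b uI h ⟨
    LBF F h G-b uI                           ∎
    where
    G-b = deleteVertex b G
    uI = λ i → u (punchIn b i)

  -- Merging two vertices

  module _ {m} (G : SimpleGraph (suc m)) (w : Fin (suc m) → Carrier)
           {keep del : Fin (suc m)} (keep≢del : keep ≢ del) where
    -- Merging del into keep moves the point w along keep − del until the
    -- weight of del vanishes.
    shift : Fin (suc m) → Carrier
    shift x = w x + w del * (δ keep x - δ del x)

    shift-del : shift del ≈ 0#
    shift-del = begin
      w del + w del * (δ keep del - δ del del) ≈⟨ +-congˡ (*-congˡ (+-cong (δ-other (keep≢del ∘ ≡.sym))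
                                                                            (-‿cong (δ-self del)))) ⟩
      w del + w del * (0# - 1#)                ≈⟨ solve 1 (λ t → t :+ t :* (con (0 , 0) :- con (1 , 0))
                                                                := con (0 , 0)) refl (w del) ⟩
      0#                                       ∎

    mergedWeights≈shift : ∀ i → mergedWeights F w keep del i ≈ shift (punchIn del i)
    mergedWeights≈shift i = merged≈shift (punchIn del i ≟ keep) (Finₚ.punchInᵢ≢i del i)
      where
      merged≈shift : ∀ {x} (x≟keep : Dec (x ≡ keep)) → x ≢ del →
        (if ⌊ x≟keep ⌋ then w keep + w del else w x) ≈ w x + w del * (𝟙 ⌊ x≟keep ⌋ - δ del x)
      merged≈shift (yes ≡.refl) _ = +-congˡ (sym (trans (*-congˡ (+-congˡ (-‿cong (δ-other keep≢del))))
        (solve 1 (λ t → t :* (con (1 , 0) :- con (0 , 0)) := t) refl (w del))))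
      merged≈shift {x} (no _) x≢del = sym (trans (+-congˡ (*-congˡ (+-congˡ (-‿cong (δ-other x≢del)))))
        (solve 2 (λ s t → s :+ t :* (con (0 , 0) :- con (0 , 0)) := s) refl (w x) (w del)))

    LBF-merge : ∀ h → LBF F h (deleteVertex del G) (mergedWeights F w keep del) ≈ LBF F h G shift
    LBF-merge h = sym (trans (LBF-punchIn h G del {shift} shift-del)
                             (LBF-cong h (deleteVertex del G) (λ i → sym (mergedWeights≈shift i))))

  module Direction {n} (G : SimpleGraph n) (w : Fin n → Carrier) {a b : Fin n}
                   (a≢b : a ≢ b) (a≁b : adj G a b ≡ false) where

    d : Fin n → Carrier
    d x = δ a x - δ b x

    d-a : d a ≈ 1#
    d-a = trans (+-cong (δ-self a) (-‿cong (δ-other a≢b))) (trans (+-congˡ -0#≈0#) (+-identityʳ 1#))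

    d-b : d b ≈ - 1#
    d-b = trans (+-congʳ (δ-other (a≢b ∘ ≡.sym))) (trans (+-congˡ (-‿cong (δ-self b))) (+-identityˡ _))

    ∑-d : ∀ (f : Fin n → Carrier) → ∑[ x < n ] (d x * f x) ≈ f a - f b
    ∑-d f = begin
      ∑[ x < n ] (d x * f x)                      ≈⟨ sum-cong-≋ (λ x →
        solve 3 (λ p q f → (p :- q) :* f := p :* f :- q :* f) refl (δ a x) (δ b x) (f x)) ⟩
      ∑[ x < n ] (δ a x * f x - δ b x * f x)      ≈⟨ ∑-sub (λ x → δ a x * f x) (λ x → δ b x * f x) ⟩
      ∑[ x < n ] (δ a x * f x) - ∑[ x < n ] (δ b x * f x) ≈⟨ +-cong (∑-δ a f) (-‿cong (∑-δ b f)) ⟩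
      f a - f b                                   ∎

    ∑-dd : ∀ (f : Fin n → Carrier) → ∑[ x < n ] (d x * (d x * f x)) ≈ f a + f b
    ∑-dd f = begin
      ∑[ x < n ] (d x * (d x * f x))  ≈⟨ ∑-d (λ x → d x * f x) ⟩
      d a * f a - d b * f b           ≈⟨ +-cong (*-congʳ d-a) (-‿cong (*-congʳ d-b)) ⟩
      1# * f a - (- 1#) * f b         ≈⟨ solve 2 (λ p q → con (1 , 0) :* p :- con (0 , 1) :* q := p :+ q)
                                                refl (f a) (f b) ⟩
      f a + f b                       ∎

    ∑-corners : ∀ (h : Fin n → Fin n → Carrier) →
      ∑[ x < n ] ∑[ y < n ] (d x * (d y * h x y)) ≈ (h a a - h a b) - (h b a - h b b)
    ∑-corners h = begin
      ∑[ x < n ] ∑[ y < n ] (d x * (d y * h x y))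
        ≈⟨ sum-cong-≋ (λ x → *-distribˡ-sum (d x) (λ y → d y * h x y)) ⟨
      ∑[ x < n ] (d x * ∑[ y < n ] (d y * h x y))  ≈⟨ ∑-d (λ x → ∑[ y < n ] (d y * h x y)) ⟩
      ∑[ y < n ] (d y * h a y) - ∑[ y < n ] (d y * h b y) ≈⟨ +-cong (∑-d (h a)) (-‿cong (∑-d (h b))) ⟩
      (h a a - h a b) - (h b a - h b b)            ∎

    weight : (Fin n → Bool) → Carrier
    weight S = ∑[ z < n ] (𝟙 (S z) * w z)

    neighbourhood : Fin n → Carrier
    neighbourhood x = weight (adj G x)

    commonNeighbourhood : Carrier
    commonNeighbourhood = weight λ z → adj G a z ∧ adj G b z

    -- The coefficients of τ, τ² and τ³ in T₃ G (w + τ d), E₃ G (w + τ d)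
    -- and E₂ G (w + τ d).
    t₃′ t₃″ t₃‴ : Fin n × Fin n × Fin n → Carrier
    t₃′ (x , y , z) = d x * w y * w z + w x * d y * w z + w x * w y * d z
    t₃″ (x , y , z) = d x * (d y * w z) + d x * (d z * w y) + d y * (d z * w x)
    t₃‴ (x , y , z) = d x * (d y * d z)

    e₃′ e₃″ e₃‴ e₂′ e₂″ : Fin n × Fin n → Carrier
    e₃′ (x , y) = (d x * w x * w y + w x * d x * w y + w x * w x * d y)
                + (d x * w y * w y + w x * d y * w y + w x * w y * d y)
    e₃″ (x , y) = (d x * d x * w y + d y * d y * w x) + d x * (d y * (w x + w x + w y + w y))
    e₃‴ (x , y) = d x * (d y * (d x + d y))
    e₂′ (x , y) = d x * w y + d y * w x
    e₂″ (x , y) = d x * d y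

    T₃′ T₃″ T₃‴ E₃′ E₃″ E₃‴ E₂′ E₂″ : Carrier
    T₃′ = tripleSum G t₃′
    T₃″ = tripleSum G t₃″
    T₃‴ = tripleSum G t₃‴
    E₃′ = edgeSum G e₃′
    E₃″ = edgeSum G e₃″
    E₃‴ = edgeSum G e₃‴
    E₂′ = edgeSum G e₂′
    E₂″ = edgeSum G e₂″

    ∑-adjacent : ∀ (g : Fin n → Carrier) →
      ∑[ x < n ] ∑[ y < n ] (𝟙 (adj G x y) * (g x * w y)) ≈ ∑[ x < n ] (g x * neighbourhood x)
    ∑-adjacent g = sum-cong-≋ λ x →
      trans (sum-cong-≋ λ y → solve 3 (λ e p q → e :* (p :* q) := p :* (e :* q)) refl _ (g x) (w y))
            (sym (*-distribˡ-sum (g x) (λ y → 𝟙 (adj G x y) * w y)))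

    b≁a : adj G b a ≡ false
    b≁a = ≡.trans (adj-sym G b a) a≁b

    edgeSum-dd : ∀ (k : Fin n → Fin n → Carrier) → edgeSum G (λ (x , y) → d x * (d y * k x y)) ≈ 0#
    edgeSum-dd k = begin
      edgeSum G (λ (x , y) → d x * (d y * k x y))      ≈⟨ sum-cong-≋ (λ x → sum-cong-≋ λ y →
        solve 4 (λ e p q k → e :* (p :* (q :* k)) := p :* (q :* (e :* k))) refl _ (d x) (d y) (k x y)) ⟩
      ∑[ x < n ] ∑[ y < n ] (d x * (d y * h x y))      ≈⟨ ∑-corners h ⟩
      (h a a - h a b) - (h b a - h b b)                ≈⟨ [p-q]-[r-s]≈0
        (h≈0 (edgeGuard-irrefl G a)) (h≈0 (edgeGuard-nonadjacent G a≁b))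
        (h≈0 (edgeGuard-nonadjacent G b≁a)) (h≈0 (edgeGuard-irrefl G b)) ⟩
      0#                                               ∎
      where
      h : Fin n → Fin n → Carrier
      h x y = 𝟙 (edgeGuard G x y) * k x y
      h≈0 : ∀ {x y} → edgeGuard G x y ≡ false → h x y ≈ 0#
      h≈0 guard≡false = x≈0⇒x*y≈0 _ (𝟙-false guard≡false)

    E₂′-value : E₂′ ≈ neighbourhood a - neighbourhood b
    E₂′-value = trans (edgeSum-symmetrise G (λ x y → d x * w y)) (trans (∑-adjacent d) (∑-d neighbourhood))

    E₂″-value : E₂″ ≈ 0#
    E₂″-value = trans (edgeSum-cong G λ x y → *-congˡ (sym (*-identityʳ (d y)))) (edgeSum-dd (λ _ _ → 1#))

    E₃″-value : E₃″ ≈ neighbourhood a + neighbourhood b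
    E₃″-value = begin
      edgeSum G (λ (x , y) → (d x * d x * w y + d y * d y * w x) + d x * (d y * (w x + w x + w y + w y)))
        ≈⟨ edgeSum-+ G _ (λ (x , y) → d x * (d y * (w x + w x + w y + w y))) ⟩
      edgeSum G (λ (x , y) → d x * d x * w y + d y * d y * w x)
        + edgeSum G (λ (x , y) → d x * (d y * (w x + w x + w y + w y)))
        ≈⟨ +-cong (edgeSum-symmetrise G (λ x y → d x * d x * w y))
                  (edgeSum-dd (λ x y → w x + w x + w y + w y)) ⟩
      ∑[ x < n ] ∑[ y < n ] (𝟙 (adj G x y) * (d x * d x * w y)) + 0#
        ≈⟨ trans (+-identityʳ _) (∑-adjacent (λ x → d x * d x)) ⟩
      ∑[ x < n ] (d x * d x * neighbourhood x)
        ≈⟨ trans (sum-cong-≋ λ x → *-assoc (d x) (d x) _) (∑-dd neighbourhood) ⟩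
      neighbourhood a + neighbourhood b ∎

    E₃‴-value : E₃‴ ≈ 0#
    E₃‴-value = edgeSum-dd (λ x y → d x + d y)

    χ : Fin n → Fin n → Fin n → Carrier
    χ x y z = 𝟙 (tripleGuard G x y z)

    private
      ∑𝟙w≈0 : ∀ (g : Fin n → Bool) → (∀ i → g i ≡ false) → ∑[ i < n ] (𝟙 (g i) * w i) ≈ 0#
      ∑𝟙w≈0 g g≡false = ∑-zero λ i → x≈0⇒x*y≈0 (w i) (𝟙-false (g≡false i))

    T₃‴-value : T₃‴ ≈ 0#
    T₃‴-value = begin
      tripleSum G (λ (x , y , z) → d x * (d y * d z))
        ≈⟨ sum-cong-≋ (λ x → sum-cong-≋ λ y →
             trans (sum-cong-≋ λ z → solve 4 (λ e p q r → e :* (p :* (q :* r)) := p :* (q :* (r :* e)))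
                                            refl (χ x y z) (d x) (d y) (d z))
                   (∑-pull₂ (d x) (d y) (λ z → d z * χ x y z))) ⟩
      ∑[ x < n ] ∑[ y < n ] (d x * (d y * ∑[ z < n ] (d z * χ x y z)))
        ≈⟨ sum-cong-≋ (λ x → sum-cong-≋ λ y → *-congˡ (*-congˡ (∑-d (χ x y)))) ⟩
      ∑[ x < n ] ∑[ y < n ] (d x * (d y * h x y))
        ≈⟨ ∑-corners h ⟩
      (h a a - h a b) - (h b a - h b b)
        ≈⟨ [p-q]-[r-s]≈0
             (x≈0⇒y≈0⇒x-y≈0 (𝟙-false (tripleGuard-repeat₁₂ G a a)) (𝟙-false (tripleGuard-repeat₁₂ G a b)))
             (x≈0⇒y≈0⇒x-y≈0 (𝟙-false (tripleGuard-repeat₁₃ G a b)) (𝟙-false (tripleGuard-repeat₂₃ G a b)))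
             (x≈0⇒y≈0⇒x-y≈0 (𝟙-false (tripleGuard-repeat₂₃ G b a)) (𝟙-false (tripleGuard-repeat₁₃ G b a)))
             (x≈0⇒y≈0⇒x-y≈0 (𝟙-false (tripleGuard-repeat₁₂ G b a)) (𝟙-false (tripleGuard-repeat₁₂ G b b))) ⟩
      0# ∎
      where
      h : Fin n → Fin n → Carrier
      h x y = χ x y a - χ x y b

    tripleSum-dd₁₂ : tripleSum G (λ (x , y , z) → d x * (d y * w z)) ≈
                     - (∑[ z < n ] (χ a b z * w z) + ∑[ z < n ] (χ b a z * w z))
    tripleSum-dd₁₂ = begin
      tripleSum G (λ (x , y , z) → d x * (d y * w z))
        ≈⟨ sum-cong-≋ (λ x → sum-cong-≋ λ y →
             trans (sum-cong-≋ λ z → solve 4 (λ e p q r → e :* (p :* (q :* r)) := p :* (q :* (e :* r)))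
                                            refl (χ x y z) (d x) (d y) (w z))
                   (∑-pull₂ (d x) (d y) (λ z → χ x y z * w z))) ⟩
      ∑[ x < n ] ∑[ y < n ] (d x * (d y * h x y))
        ≈⟨ ∑-corners h ⟩
      (h a a - h a b) - (h b a - h b b)
        ≈⟨ [p-q]-[r-s]≈-[q+r] (h a b) (h b a) (∑𝟙w≈0 (tripleGuard G a a) (tripleGuard-repeat₁₂ G a))
                                              (∑𝟙w≈0 (tripleGuard G b b) (tripleGuard-repeat₁₂ G b)) ⟩
      - (h a b + h b a) ∎
      where
      h : Fin n → Fin n → Carrier
      h x y = ∑[ z < n ] (χ x y z * w z)

    tripleSum-dd₁₃ : tripleSum G (λ (x , y , z) → d x * (d z * w y)) ≈
                     - (∑[ y < n ] (χ a y b * w y) + ∑[ y < n ] (χ b y a * w y))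
    tripleSum-dd₁₃ = begin
      tripleSum G (λ (x , y , z) → d x * (d z * w y))
        ≈⟨ sum-cong-≋ (λ x → ∑-comm (λ y z → χ x y z * (d x * (d z * w y)))) ⟩
      ∑[ x < n ] ∑[ z < n ] ∑[ y < n ] (χ x y z * (d x * (d z * w y)))
        ≈⟨ sum-cong-≋ (λ x → sum-cong-≋ λ z →
             trans (sum-cong-≋ λ y → solve 4 (λ e p q r → e :* (p :* (q :* r)) := p :* (q :* (e :* r)))
                                            refl (χ x y z) (d x) (d z) (w y))
                   (∑-pull₂ (d x) (d z) (λ y → χ x y z * w y))) ⟩
      ∑[ x < n ] ∑[ z < n ] (d x * (d z * h x z))
        ≈⟨ ∑-corners h ⟩
      (h a a - h a b) - (h b a - h b b)
        ≈⟨ [p-q]-[r-s]≈-[q+r] (h a b) (h b a) (∑𝟙w≈0 (λ y → tripleGuard G a y a) (tripleGuard-repeat₁₃ G a))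
                                              (∑𝟙w≈0 (λ y → tripleGuard G b y b) (tripleGuard-repeat₁₃ G b)) ⟩
      - (h a b + h b a) ∎
      where
      h : Fin n → Fin n → Carrier
      h x z = ∑[ y < n ] (χ x y z * w y)

    tripleSum-dd₂₃ : tripleSum G (λ (x , y , z) → d y * (d z * w x)) ≈
                     - (∑[ x < n ] (χ x a b * w x) + ∑[ x < n ] (χ x b a * w x))
    tripleSum-dd₂₃ = begin
      tripleSum G (λ (x , y , z) → d y * (d z * w x))
        ≈⟨ ∑-comm (λ x y → ∑[ z < n ] (χ x y z * (d y * (d z * w x)))) ⟩
      ∑[ y < n ] ∑[ x < n ] ∑[ z < n ] (χ x y z * (d y * (d z * w x)))
        ≈⟨ sum-cong-≋ (λ y → ∑-comm (λ x z → χ x y z * (d y * (d z * w x)))) ⟩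
      ∑[ y < n ] ∑[ z < n ] ∑[ x < n ] (χ x y z * (d y * (d z * w x)))
        ≈⟨ sum-cong-≋ (λ y → sum-cong-≋ λ z →
             trans (sum-cong-≋ λ x → solve 4 (λ e p q r → e :* (p :* (q :* r)) := p :* (q :* (e :* r)))
                                            refl (χ x y z) (d y) (d z) (w x))
                   (∑-pull₂ (d y) (d z) (λ x → χ x y z * w x))) ⟩
      ∑[ y < n ] ∑[ z < n ] (d y * (d z * h y z))
        ≈⟨ ∑-corners h ⟩
      (h a a - h a b) - (h b a - h b b)
        ≈⟨ [p-q]-[r-s]≈-[q+r] (h a b) (h b a)
             (∑𝟙w≈0 (λ x → tripleGuard G x a a) (λ x → tripleGuard-repeat₂₃ G x a))
             (∑𝟙w≈0 (λ x → tripleGuard G x b b) (λ x → tripleGuard-repeat₂₃ G x b)) ⟩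
      - (h a b + h b a) ∎
      where
      h : Fin n → Fin n → Carrier
      h y z = ∑[ x < n ] (χ x y z * w x)

    arrangementsWeight :
      (∑[ z < n ] (χ a b z * w z) + ∑[ z < n ] (χ b a z * w z)) +
      (∑[ z < n ] (χ a z b * w z) + ∑[ z < n ] (χ b z a * w z)) +
      (∑[ z < n ] (χ z a b * w z) + ∑[ z < n ] (χ z b a * w z)) ≈ commonNeighbourhood
    arrangementsWeight = begin
      (∑[ z < n ] (χ a b z * w z) + ∑[ z < n ] (χ b a z * w z)) +
      (∑[ z < n ] (χ a z b * w z) + ∑[ z < n ] (χ b z a * w z)) +
      (∑[ z < n ] (χ z a b * w z) + ∑[ z < n ] (χ z b a * w z))
        ≈⟨ +-cong (+-cong (sym (∑-distrib-+ (λ z → χ a b z * w z) (λ z → χ b a z * w z)))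
                          (sym (∑-distrib-+ (λ z → χ a z b * w z) (λ z → χ b z a * w z))))
                  (sym (∑-distrib-+ (λ z → χ z a b * w z) (λ z → χ z b a * w z))) ⟩
      sum pA + sum pB + sum pC
        ≈⟨ +-congʳ (sym (∑-distrib-+ pA pB)) ⟩
      ∑[ z < n ] (pA z + pB z) + sum pC
        ≈⟨ sym (∑-distrib-+ (λ z → pA z + pB z) pC) ⟩
      ∑[ z < n ] (pA z + pB z + pC z)
        ≈⟨ sum-cong-≋ (λ z → trans
             (solve 7 (λ t₁ t₂ t₃ t₄ t₅ t₆ w →
                        (t₁ :* w :+ t₂ :* w) :+ (t₃ :* w :+ t₄ :* w) :+ (t₅ :* w :+ t₆ :* w)
                        := (t₁ :+ t₂ :+ t₃ :+ t₄ :+ t₅ :+ t₆) :* w)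
                    refl (χ a b z) (χ b a z) (χ a z b) (χ b z a) (χ z a b) (χ z b a) (w z))
             (*-congʳ (𝟙-sum₆ (tripleGuard G a b z) (tripleGuard G b a z) (tripleGuard G a z b)
                               (tripleGuard G b z a) (tripleGuard G z a b) (tripleGuard G z b a)
                               (arrangementsOfNonEdge G a≢b a≁b z)))) ⟩
      commonNeighbourhood ∎
      where
      pA pB pC : Fin n → Carrier
      pA z = χ a b z * w z + χ b a z * w z
      pB z = χ a z b * w z + χ b z a * w z
      pC z = χ z a b * w z + χ z b a * w z

    T₃″-value : T₃″ ≈ - commonNeighbourhood
    T₃″-value = begin
      tripleSum G (λ (x , y , z) → d x * (d y * w z) + d x * (d z * w y) + d y * (d z * w x))
        ≈⟨ trans (tripleSum-+ G _ (λ (x , y , z) → d y * (d z * w x)))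
                 (+-congʳ (tripleSum-+ G (λ (x , y , z) → d x * (d y * w z))
                                         (λ (x , y , z) → d x * (d z * w y)))) ⟩
      tripleSum G (λ (x , y , z) → d x * (d y * w z)) + tripleSum G (λ (x , y , z) → d x * (d z * w y))
        + tripleSum G (λ (x , y , z) → d y * (d z * w x))
        ≈⟨ +-cong (+-cong tripleSum-dd₁₂ tripleSum-dd₁₃) tripleSum-dd₂₃ ⟩
      - P + - Q + - R  ≈⟨ solve 3 (λ p q r → :- p :+ :- q :+ :- r := :- (p :+ q :+ r)) refl P Q R ⟩
      - (P + Q + R)    ≈⟨ -‿cong arrangementsWeight ⟩
      - commonNeighbourhood ∎
      where
      P Q R : Carrier
      P = ∑[ z < n ] (χ a b z * w z) + ∑[ z < n ] (χ b a z * w z)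
      Q = ∑[ y < n ] (χ a y b * w y) + ∑[ y < n ] (χ b y a * w y)
      R = ∑[ x < n ] (χ x a b * w x) + ∑[ x < n ] (χ x b a * w x)

    β α : Carrier → Carrier
    β h = T₃′ + h * E₃′ - h * (E₂ G w * E₂′ + E₂′ * E₂ G w)
    α h = T₃″ + h * E₃″ - h * (E₂′ * E₂′)

    module _ (τ : Carrier) where
      T₃-expansion : T₃ G (λ x → w x + τ * d x) ≈ T₃ G w + τ * (T₃′ + τ * (T₃″ + τ * T₃‴))
      T₃-expansion = trans
        (tripleSum-cong G λ x y z → solve 7 (λ wx wy wz dx dy dz t →
           (wx :+ t :* dx) :* (wy :+ t :* dy) :* (wz :+ t :* dz)
           := wx :* wy :* wz :+ t :* ((dx :* wy :* wz :+ wx :* dy :* wz :+ wx :* wy :* dz)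
                            :+ t :* ((dx :* (dy :* wz) :+ dx :* (dz :* wy) :+ dy :* (dz :* wx))
                            :+ t :* (dx :* (dy :* dz)))))
           refl (w x) (w y) (w z) (d x) (d y) (d z) τ)
        (Linear⇒cubic (tripleSum-linear G) τ (λ (x , y , z) → w x * w y * w z) t₃′ t₃″ t₃‴)

      E₃-expansion : E₃ G (λ x → w x + τ * d x) ≈ E₃ G w + τ * (E₃′ + τ * (E₃″ + τ * E₃‴))
      E₃-expansion = trans
        (edgeSum-cong G λ x y → solve 5 (λ wx wy dx dy t →
           (wx :+ t :* dx) :* (wx :+ t :* dx) :* (wy :+ t :* dy)
             :+ (wx :+ t :* dx) :* (wy :+ t :* dy) :* (wy :+ t :* dy)
           := (wx :* wx :* wy :+ wx :* wy :* wy)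
              :+ t :* (((dx :* wx :* wy :+ wx :* dx :* wy :+ wx :* wx :* dy)
                       :+ (dx :* wy :* wy :+ wx :* dy :* wy :+ wx :* wy :* dy))
              :+ t :* (((dx :* dx :* wy :+ dy :* dy :* wx) :+ dx :* (dy :* (wx :+ wx :+ wy :+ wy)))
              :+ t :* (dx :* (dy :* (dx :+ dy))))))
           refl (w x) (w y) (d x) (d y) τ)
        (Linear⇒cubic (edgeSum-linear G) τ (λ (x , y) → w x * w x * w y + w x * w y * w y) e₃′ e₃″ e₃‴)

      E₂-expansion : E₂ G (λ x → w x + τ * d x) ≈ E₂ G w + τ * (E₂′ + τ * E₂″)
      E₂-expansion = trans
        (edgeSum-cong G λ x y → solve 5 (λ wx wy dx dy t →
           (wx :+ t :* dx) :* (wy :+ t :* dy) := wx :* wy :+ t :* ((dx :* wy :+ dy :* wx) :+ t :* (dx :* dy)))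
           refl (w x) (w y) (d x) (d y) τ)
        (Linear⇒quadratic (edgeSum-linear G) τ (λ (x , y) → w x * w y) e₂′ e₂″)

      LBF-expansion : ∀ h → LBF F h G (λ x → w x + τ * d x) ≈ LBF F h G w + τ * (β h + τ * α h)
      LBF-expansion h = begin
        LBF F h G u                         ≈⟨ LBF≈ℓ G u h ⟩
        ℓ h (T₃ G u) (E₃ G u) (E₂ G u)      ≈⟨ ℓ-cong h
          (trans T₃-expansion (+-congˡ (*-congˡ (+-congˡ (*-congˡ (+-congˡ (*-congˡ T₃‴-value)))))))
          (trans E₃-expansion (+-congˡ (*-congˡ (+-congˡ (*-congˡ (+-congˡ (*-congˡ E₃‴-value)))))))
          (trans E₂-expansion (+-congˡ (*-congˡ (+-congˡ (*-congˡ E₂″-value))))) ⟩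
        ℓ h (T₀ + τ * (T₃′ + τ * (T₃″ + τ * 0#))) (E₀ + τ * (E₃′ + τ * (E₃″ + τ * 0#)))
            (D₀ + τ * (E₂′ + τ * 0#))
          ≈⟨ solve 10 (λ T₀ T₁ T₂ S₀ S₁ S₂ D₀ D₁ t h →
               let ℓ′ = λ T S D → T :+ h :* S :- h :* (D :* D) in
               ℓ′ (T₀ :+ t :* (T₁ :+ t :* (T₂ :+ t :* con (0 , 0))))
                  (S₀ :+ t :* (S₁ :+ t :* (S₂ :+ t :* con (0 , 0))))
                  (D₀ :+ t :* (D₁ :+ t :* con (0 , 0)))
               := ℓ′ T₀ S₀ D₀ :+ t :* ((T₁ :+ h :* S₁ :- h :* (D₀ :* D₁ :+ D₁ :* D₀))
                                  :+ t :* (T₂ :+ h :* S₂ :- h :* (D₁ :* D₁))))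
               refl T₀ T₃′ T₃″ E₀ E₃′ E₃″ D₀ E₂′ τ h ⟩
        ℓ h T₀ E₀ D₀ + τ * (β h + τ * α h)  ≈⟨ +-congʳ (LBF≈ℓ G w h) ⟨
        LBF F h G w + τ * (β h + τ * α h)   ∎
        where
        u : Fin n → Carrier
        u x = w x + τ * d x
        T₀ = T₃ G w
        E₀ = E₃ G w
        D₀ = E₂ G w

    module _ {h : Carrier} (h+h≈1 : h + h ≈ 1#) (w≥0 : ∀ x → 0# ≤ w x) (∑w≈1 : sum w ≈ 1#) where
      private
        onlyA onlyB : Fin n → Bool
        onlyA z = adj G a z ∧ not (adj G b z)
        onlyB z = not (adj G a z) ∧ adj G b z

        X Y C : Carrier
        X = weight onlyA
        Y = weight onlyB
        C = commonNeighbourhood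

      weight-nonneg : ∀ S → 0# ≤ weight S
      weight-nonneg S = ∑-nonneg λ z → *-nonneg (𝟙-nonneg (S z)) (w≥0 z)

      neighbourhood-a : neighbourhood a ≈ X + C
      neighbourhood-a = trans
        (sum-cong-≋ λ z → trans (*-congʳ (𝟙-split (adj G a z) (adj G b z))) (distribʳ (w z) _ _))
        (∑-distrib-+ {n} _ _)

      neighbourhood-b : neighbourhood b ≈ Y + C
      neighbourhood-b = trans
        (sum-cong-≋ λ z → trans (*-congʳ (𝟙-split′ (adj G a z) (adj G b z))) (distribʳ (w z) _ _))
        (∑-distrib-+ {n} _ _)

      X+Y≤1 : (X + Y) ≤ 1#
      X+Y≤1 = ≤-resp-≈ (∑-distrib-+ {n} _ _) ∑w≈1
                       (∑-mono λ z → 𝟙-exclusive≤ (adj G a z) (adj G b z) (w≥0 z))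

      -- The neighbourhoods of a and b have weights X + C and Y + C, so the
      -- quadratic coefficient is h ((X + Y) − (X − Y)²), and
      -- (X − Y)² ≤ (X + Y)² ≤ X + Y.
      α-nonneg : 0# ≤ α h
      α-nonneg = ≤-respʳ-≈ (sym α≈) (*-nonneg (half-nonneg h+h≈1) (≤-respʳ-≈ (sym gap≈) gap-nonneg))
        where
        Na = neighbourhood a
        Nb = neighbourhood b

        α≈ : α h ≈ h * ((X + Y) - (X - Y) * (X - Y))
        α≈ = begin
          ℓ h T₃″ E₃″ E₂′                      ≈⟨ ℓ-cong h T₃″-value E₃″-value E₂′-value ⟩
          ℓ h (- C) (Na + Nb) (Na - Nb)        ≈⟨ ℓ-cong h refl (+-cong neighbourhood-a neighbourhood-b)
                                                      (+-cong neighbourhood-a (-‿cong neighbourhood-b)) ⟩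
          ℓ h (- C) ((X + C) + (Y + C)) ((X + C) - (Y + C))
            ≈⟨ solve 4 (λ h x y c →
                 :- c :+ h :* ((x :+ c) :+ (y :+ c)) :- h :* (((x :+ c) :- (y :+ c)) :* ((x :+ c) :- (y :+ c)))
                 := h :* ((x :+ y) :- (x :- y) :* (x :- y)) :+ (c :* (h :+ h) :- c)) refl h X Y C ⟩
          h * ((X + Y) - (X - Y) * (X - Y)) + (C * (h + h) - C)
            ≈⟨ +-congˡ (trans (+-congʳ (trans (*-congˡ h+h≈1) (*-identityʳ C))) (-‿inverseʳ C)) ⟩
          h * ((X + Y) - (X - Y) * (X - Y)) + 0#
            ≈⟨ +-identityʳ _ ⟩
          h * ((X + Y) - (X - Y) * (X - Y))    ∎

        gap≈ : (X + Y) - (X - Y) * (X - Y) ≈ (X + Y) * (1# - (X + Y)) + ((X * Y + X * Y) + (X * Y + X * Y))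
        gap≈ = solve 2 (λ x y → (x :+ y) :- (x :- y) :* (x :- y)
                                := (x :+ y) :* (con (1 , 0) :- (x :+ y))
                                   :+ ((x :* y :+ x :* y) :+ (x :* y :+ x :* y)))
                       refl X Y

        gap-nonneg : 0# ≤ ((X + Y) * (1# - (X + Y)) + ((X * Y + X * Y) + (X * Y + X * Y)))
        gap-nonneg = +-nonneg (*-nonneg (+-nonneg 0≤X 0≤Y) (x≤y⇒0≤y-x X+Y≤1))
                              (+-nonneg (+-nonneg 0≤XY 0≤XY) (+-nonneg 0≤XY 0≤XY))
          where
          0≤X = weight-nonneg onlyA
          0≤Y = weight-nonneg onlyB
          0≤XY = *-nonneg 0≤X 0≤Y

  module _ {m} (G : SimpleGraph (suc m)) (w : Fin (suc m) → Carrier) {a b : Fin (suc m)}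
           (a≢b : a ≢ b) (a≁b : adj G a b ≡ false) where
    open Direction G w a≢b a≁b

    LBF-merge-b-into-a : ∀ h → LBF F h (deleteVertex b G) (mergedWeights F w a b) ≈
                               LBF F h G w + w b * (β h + w b * α h)
    LBF-merge-b-into-a h = trans (LBF-merge G w a≢b h) (LBF-expansion (w b) h)

    LBF-merge-a-into-b : ∀ h → LBF F h (deleteVertex a G) (mergedWeights F w b a) ≈
                               LBF F h G w + (- w a) * (β h + (- w a) * α h)
    LBF-merge-a-into-b h = trans (LBF-merge G w (a≢b ∘ ≡.sym) h) (trans (LBF-cong h G λ x →
      solve 4 (λ wx wa p q → wx :+ wa :* (q :- p) := wx :+ (:- wa) :* (p :- q))
              refl (w x) (w a) (δ a x) (δ b x))
      (LBF-expansion (- w a) h))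

lemma3p1 : ∀ {c ℓ₁ ℓ₂ : Level} (F : OrderedField c ℓ₁ ℓ₂) →
    let open OrderedField F in
    (half : Carrier) → half + half ≈ 1# →
    (m : ℕ) (G : SimpleGraph (suc m)) (w : Fin (suc m) → Carrier) →
    (∀ x → 0# ≤ w x) → sumFin F (suc m) w ≈ 1# →
    (a b : Fin (suc m)) → a ≢ b → adj G a b ≡ false →
    (LBF F half G w ≤ LBF F half (deleteVertex b G) (mergedWeights F w a b))
    ⊎ (LBF F half G w ≤ LBF F half (deleteVertex a G) (mergedWeights F w b a))
lemma3p1 F half half+half≈1 m G w w≥0 ∑w≈1 a b a≢b a≁b =
  Sum.map gain-b-into-a gain-a-into-b (total 0# (β half))
  where
  open OrderedField F
  open IsTotalOrder isTotalOrder using (total; ≤-respʳ-≈)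
  open LBFProperties F
  open Direction G w a≢b a≁b

  0≤α : 0# ≤ α half
  0≤α = α-nonneg half+half≈1 w≥0 (trans (reflexive (≡.sym (sumFin≡sum (suc m) w))) ∑w≈1)

  gain-b-into-a : 0# ≤ β half → LBF F half G w ≤ LBF F half (deleteVertex b G) (mergedWeights F w a b)
  gain-b-into-a 0≤β = ≤-respʳ-≈ (sym (LBF-merge-b-into-a G w a≢b a≁b half))
    (x≤x+y _ (0≤τ[β+τα] (*-nonneg (w≥0 b) 0≤β) 0≤α))

  gain-a-into-b : β half ≤ 0# → LBF F half G w ≤ LBF F half (deleteVertex a G) (mergedWeights F w b a)
  gain-a-into-b β≤0 = ≤-respʳ-≈ (sym (LBF-merge-a-into-b G w a≢b a≁b half))
    (x≤x+y _ (0≤τ[β+τα] (0≤-x*y (w≥0 a) β≤0) 0≤α))
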